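{- Let $F_1, F_2\colon \mathsf{Set}\to\mathsf{Set}$ be functors, where for $i=1,2$ the functor $F_i$ carries an encoding $(A_i, (\flat_{X,i})_X)$ and $\mathrm{sig}_i\colon F_i1\times\mathcal{B}(A_i\times\mathbb{N})\to F_i\mathbb{N}$ is a signature interface for $F_i$ with respect to this encoding. Put $A = A_1 + A_2$ with coproduct injections $\mathrm{in}_i\colon A_i\to A$, and define $\mathrm{filter}_i\colon \mathcal{B}(A\times\mathbb{N})\to\mathcal{B}(A_i\times\mathbb{N})$ by $\mathrm{filter}_i(b)(a,n) = b(\mathrm{in}_i\,a, n)$. (1) For the product functor $F = F_1\times F_2$ (so $F1 = F_11\times F_21$, with projections $\mathrm{pr}_i\colon F1\to F_i1$), equipped with the product encoding, the function $\mathrm{sig}\colon F1\times\mathcal{B}(A\times\mathbb{N})\to F_1\mathbb{N}\times F_2\mathbb{N}$ given by $\mathrm{sig}(t,b) = \big(\mathrm{sig}_1(\mathrm{pr}_1(t),\mathrm{filter}_1(b)),\ \mathrm{sig}_2(\mathrm{pr}_2(t),\mathrm{filter}_2(b))\big)$ is a signature interface for $F$. (2) For the coproduct functor $F = F_1 + F_2$ (so $F1 = F_11 + F_21$), equipped with the coproduct encoding, the function $\mathrm{sig}\colon F1\times\mathcal{B}(A\times\mathbb{N})\to F_1\mathbb{N}+F_2\mathbb{N}$ given by $\mathrm{sig}(\mathrm{in}_i\,t, b) = \mathrm{in}_i\big(\mathrm{sig}_i(t,\mathrm{filter}_i(b))\big)$ for $t\in F_i1$, $i=1,2$, is a signature interface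 for $F$.
   Context: $\mathcal{B}$ denotes the bag (finite multiset) functor: $\mathcal{B}X$ is the set of finitely supported maps $X\to\mathbb{N}$, and for $f\colon X\to Y$, $\mathcal{B}f(b)(y)=\sum_{x: f(x)=y} b(x)$. $1=\{*\}$ is a singleton and $!\colon X\to 1$ the unique map; $\langle f,g\rangle(x) = (f(x),g(x))$. An encoding of a functor $F\colon\mathsf{Set}\to\mathsf{Set}$ consists of a set $A$ of labels and a family of maps $\flat_X\colon FX\to\mathcal{B}(A\times X)$, one for each set $X$, such that $\langle F!,\flat_X\rangle\colon FX\to F1\times\mathcal{B}(A\times X)$ is injective. Given an encoding $(A,\flat)$ of $F$, a signature interface is a function $\mathrm{sig}\colon F1\times\mathcal{B}(A\times\mathbb{N})\to F\mathbb{N}$ such that for every finite set $S$ and every map $\pi\colon S\to\mathbb{N}$ we have $F\pi = \mathrm{sig}\circ (\mathrm{id}_{F1}\times\mathcal{B}(A\times\pi))\circ\langle F!,\flat_S\rangle$ as maps $FS\to F\mathbb{N}$. Product and coproduct encodings (label set $A=A_1+A_2$): for $F=F_1\times F_2$, $\flat_X\colon F_1X\times F_2X\to\mathcal{B}(A\times X)$ is $\flat_X(t)(\mathrm{in}_i(a),x) = \flat_{X,i}(\mathrm{pr}_i(t))(a,x)$; for $F=F_1+F_2$, $\flat_X(\mathrm{in}_i\,t) = \mathcal{B}(\mathrm{in}_i\times X)(\flat_{X,i}(t))$ for $t\in F_iX$. -}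

module Defs where

open import Data.Nat using (ℕ)
open import Data.Fin using (Fin)
open import Data.Unit using (⊤; tt)
open import Data.Product using (_×_; _,_; proj₁; proj₂; Σ)
open import Data.Sum using (_⊎_; inj₁; inj₂)
open import Data.Maybe using (Maybe; just; nothing)
open import Data.List using (List; map; _++_; mapMaybe)
open import Data.List.Relation.Binary.Permutation.Propositional using (_↭_)
open import Function using (_∘_; id)
open import Function.Bundles using (_↔_)
open import Relation.Binary.PropositionalEquality using (_≡_; refl; cong₂)

-- Bags (finite multisets).  A finitely supported map X → ℕ is represented
-- by a list of elements of X, considered up to permutation (_↭_).
-- 𝓑 f is 'map f' (multiplicities of preimages add up).

𝓑 : Set → Set
𝓑 X = List X

𝓑map : {X Y : Set} → (X → Y) → 𝓑 X → 𝓑 Y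
𝓑map = map

_≈ᴮ_ : {X : Set} → 𝓑 X → 𝓑 X → Set
_≈ᴮ_ = _↭_

record SetFunctor : Set₁ where
  field
    F     : Set → Set
    fmap  : {X Y : Set} → (X → Y) → F X → F Y
    fmap-id : {X : Set} (t : F X) → fmap id t ≡ t
    fmap-∘  : {X Y Z : Set} (g : Y → Z) (f : X → Y) (t : F X) →
              fmap (g ∘ f) t ≡ fmap g (fmap f t)
open SetFunctor public

1ₛ : Set
1ₛ = ⊤

! : {X : Set} → X → 1ₛ
! _ = tt

Flat : SetFunctor → Set → Set₁
Flat Fn A = (X : Set) → F Fn X → 𝓑 (A × X)

record Encoding (Fn : SetFunctor) : Set₁ where
  field
    Label : Set
    flat  : Flat Fn Label
    injective : (X : Set) (t t′ : F Fn X) →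
                fmap Fn ! t ≡ fmap Fn ! t′ → flat X t ≈ᴮ flat X t′ → t ≡ t′
open Encoding public

IsFinite : Set → Set
IsFinite S = Σ ℕ λ n → S ↔ Fin n

-- A signature interface sig : F1 × 𝓑(A × ℕ) → Fℕ.  Since bags are lists
-- up to permutation, a function on bags is a list function invariant
-- under permutation (first field).
record IsSigInterface (Fn : SetFunctor) {A : Set} (♭ : Flat Fn A)
       (sig : F Fn 1ₛ × 𝓑 (A × ℕ) → F Fn ℕ) : Set₁ where
  field
    sig-resp : (t : F Fn 1ₛ) (b b′ : 𝓑 (A × ℕ)) → b ≈ᴮ b′ → sig (t , b) ≡ sig (t , b′)
    sig-eq   : (S : Set) → IsFinite S → (π : S → ℕ) (t : F Fn S) →
               fmap Fn π t ≡ sig (fmap Fn ! t , 𝓑map (λ { (a , s) → (a , π s) }) (♭ S t))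

_⊗_ : SetFunctor → SetFunctor → SetFunctor
F₁ ⊗ F₂ = record
  { F = λ X → F F₁ X × F F₂ X
  ; fmap = λ f t → (fmap F₁ f (proj₁ t) , fmap F₂ f (proj₂ t))
  ; fmap-id = λ t → cong₂ _,_ (fmap-id F₁ (proj₁ t)) (fmap-id F₂ (proj₂ t))
  ; fmap-∘ = λ g f t → cong₂ _,_ (fmap-∘ F₁ g f (proj₁ t)) (fmap-∘ F₂ g f (proj₂ t))
  }

_⊕_ : SetFunctor → SetFunctor → SetFunctor
F₁ ⊕ F₂ = record
  { F = λ X → F F₁ X ⊎ F F₂ X
  ; fmap = fm
  ; fmap-id = fid
  ; fmap-∘ = fcomp
  }
  where
  fm : {X Y : Set} → (X → Y) → F F₁ X ⊎ F F₂ X → F F₁ Y ⊎ F F₂ Y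
  fm f (inj₁ t) = inj₁ (fmap F₁ f t)
  fm f (inj₂ t) = inj₂ (fmap F₂ f t)
  fid : {X : Set} (t : F F₁ X ⊎ F F₂ X) → fm id t ≡ t
  fid (inj₁ t) rewrite fmap-id F₁ t = refl
  fid (inj₂ t) rewrite fmap-id F₂ t = refl
  fcomp : {X Y Z : Set} (g : Y → Z) (f : X → Y) (t : F F₁ X ⊎ F F₂ X) →
          fm (g ∘ f) t ≡ fm g (fm f t)
  fcomp g f (inj₁ t) rewrite fmap-∘ F₁ g f t = refl
  fcomp g f (inj₂ t) rewrite fmap-∘ F₂ g f t = refl

inl× : {A₁ A₂ X : Set} → A₁ × X → (A₁ ⊎ A₂) × X
inl× (a , x) = (inj₁ a , x)

inr× : {A₁ A₂ X : Set} → A₂ × X → (A₁ ⊎ A₂) × X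
inr× (a , x) = (inj₂ a , x)

-- product encoding: multiplicity of (in_i a, x) is that of (a,x) in ♭_i(pr_i t)
prodFlat : (F₁ F₂ : SetFunctor) {A₁ A₂ : Set} →
           Flat F₁ A₁ → Flat F₂ A₂ → Flat (F₁ ⊗ F₂) (A₁ ⊎ A₂)
prodFlat F₁ F₂ ♭₁ ♭₂ X (t₁ , t₂) = map inl× (♭₁ X t₁) ++ map inr× (♭₂ X t₂)

coprodFlat : (F₁ F₂ : SetFunctor) {A₁ A₂ : Set} →
             Flat F₁ A₁ → Flat F₂ A₂ → Flat (F₁ ⊕ F₂) (A₁ ⊎ A₂)
coprodFlat F₁ F₂ ♭₁ ♭₂ X (inj₁ t) = 𝓑map inl× (♭₁ X t)
coprodFlat F₁ F₂ ♭₁ ♭₂ X (inj₂ t) = 𝓑map inr× (♭₂ X t)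

sel₁ : {A₁ A₂ : Set} → (A₁ ⊎ A₂) × ℕ → Maybe (A₁ × ℕ)
sel₁ (inj₁ a , n) = just (a , n)
sel₁ (inj₂ _ , _) = nothing

sel₂ : {A₁ A₂ : Set} → (A₁ ⊎ A₂) × ℕ → Maybe (A₂ × ℕ)
sel₂ (inj₁ _ , _) = nothing
sel₂ (inj₂ a , n) = just (a , n)

filter₁ : {A₁ A₂ : Set} → 𝓑 ((A₁ ⊎ A₂) × ℕ) → 𝓑 (A₁ × ℕ)
filter₁ = mapMaybe sel₁

filter₂ : {A₁ A₂ : Set} → 𝓑 ((A₁ ⊎ A₂) × ℕ) → 𝓑 (A₂ × ℕ)
filter₂ = mapMaybe sel₂

prodSig : (F₁ F₂ : SetFunctor) {A₁ A₂ : Set} →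
          (F F₁ 1ₛ × 𝓑 (A₁ × ℕ) → F F₁ ℕ) →
          (F F₂ 1ₛ × 𝓑 (A₂ × ℕ) → F F₂ ℕ) →
          F (F₁ ⊗ F₂) 1ₛ × 𝓑 ((A₁ ⊎ A₂) × ℕ) → F (F₁ ⊗ F₂) ℕ
prodSig F₁ F₂ sig₁ sig₂ (t , b) =
  (sig₁ (proj₁ t , filter₁ b) , sig₂ (proj₂ t , filter₂ b))

coprodSig : (F₁ F₂ : SetFunctor) {A₁ A₂ : Set} →
            (F F₁ 1ₛ × 𝓑 (A₁ × ℕ) → F F₁ ℕ) →
            (F F₂ 1ₛ × 𝓑 (A₂ × ℕ) → F F₂ ℕ) →
            F (F₁ ⊕ F₂) 1ₛ × 𝓑 ((A₁ ⊎ A₂) × ℕ) → F (F₁ ⊕ F₂) ℕ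
coprodSig F₁ F₂ sig₁ sig₂ (inj₁ t , b) = inj₁ (sig₁ (t , filter₁ b))
coprodSig F₁ F₂ sig₁ sig₂ (inj₂ t , b) = inj₂ (sig₂ (t , filter₂ b))

{-# OPTIONS --safe #-}
module Submission where

-- Relabelling by π : S → ℕ commutes with tagging labels by inj₁/inj₂, and filterᵢ undoes
-- the tagging by inᵢ while discarding the other summand.  So filterᵢ of the relabelled
-- combined flattening is the relabelled i-th flattening, and each component of the
-- combined interface equation is the equation of the corresponding factor.

open import Defs
open import Data.Nat using (ℕ)
open import Data.Product using (_×_; _,_; map₂)
open import Data.Sum using (_⊎_; inj₁; inj₂)
open import Data.List using ([]; map; _++_)
open import Data.List.Properties
  using (map-++; map-∘; mapMaybe-++; mapMaybe-map-retract; mapMaybe-map-none;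
         ++-identityʳ)
open import Data.List.Relation.Binary.Permutation.Propositional.Properties
  using (mapMaybe-↭)
open import Relation.Binary.PropositionalEquality
  using (_≡_; refl; sym; trans; cong; cong₂; module ≡-Reasoning)

relabel : {A S : Set} → (S → ℕ) → 𝓑 (A × S) → 𝓑 (A × ℕ)
relabel π = 𝓑map (map₂ π)

module _ {A₁ A₂ : Set} where

  filter₁-resp : {b b′ : 𝓑 ((A₁ ⊎ A₂) × ℕ)} → b ≈ᴮ b′ → filter₁ b ≈ᴮ filter₁ b′
  filter₁-resp = mapMaybe-↭ sel₁

  filter₂-resp : {b b′ : 𝓑 ((A₁ ⊎ A₂) × ℕ)} → b ≈ᴮ b′ → filter₂ b ≈ᴮ filter₂ b′
  filter₂-resp = mapMaybe-↭ sel₂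

  filter₁-inl× : (b : 𝓑 (A₁ × ℕ)) → filter₁ {A₂ = A₂} (map inl× b) ≡ b
  filter₁-inl× = mapMaybe-map-retract λ _ → refl

  filter₁-inr× : (b : 𝓑 (A₂ × ℕ)) → filter₁ {A₁} (map inr× b) ≡ []
  filter₁-inr× = mapMaybe-map-none λ _ → refl

  filter₂-inl× : (b : 𝓑 (A₁ × ℕ)) → filter₂ {A₂ = A₂} (map inl× b) ≡ []
  filter₂-inl× = mapMaybe-map-none λ _ → refl

  filter₂-inr× : (b : 𝓑 (A₂ × ℕ)) → filter₂ {A₁} (map inr× b) ≡ b
  filter₂-inr× = mapMaybe-map-retract λ _ → refl

  filter₁-++ : (b₁ : 𝓑 (A₁ × ℕ)) (b₂ : 𝓑 (A₂ × ℕ)) →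
               filter₁ (map inl× b₁ ++ map inr× b₂) ≡ b₁
  filter₁-++ b₁ b₂ = begin
    filter₁ (map inl× b₁ ++ map inr× b₂)
      ≡⟨ mapMaybe-++ sel₁ (map inl× b₁) (map inr× b₂) ⟩
    filter₁ (map inl× b₁) ++ filter₁ (map inr× b₂)
      ≡⟨ cong₂ _++_ (filter₁-inl× b₁) (filter₁-inr× b₂) ⟩
    b₁ ++ []
      ≡⟨ ++-identityʳ b₁ ⟩
    b₁ ∎
    where open ≡-Reasoning

  filter₂-++ : (b₁ : 𝓑 (A₁ × ℕ)) (b₂ : 𝓑 (A₂ × ℕ)) →
               filter₂ (map inl× b₁ ++ map inr× b₂) ≡ b₂
  filter₂-++ b₁ b₂ = begin
    filter₂ (map inl× b₁ ++ map inr× b₂)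
      ≡⟨ mapMaybe-++ sel₂ (map inl× b₁) (map inr× b₂) ⟩
    filter₂ (map inl× b₁) ++ filter₂ (map inr× b₂)
      ≡⟨ cong₂ _++_ (filter₂-inl× b₁) (filter₂-inr× b₂) ⟩
    b₂ ∎
    where open ≡-Reasoning

module _ {A₁ A₂ S : Set} (π : S → ℕ) where

  -- Both sides map the same function, since map₂ π ∘ inl× and inl× ∘ map₂ π agree definitionally.
  relabel-inl× : (l : 𝓑 (A₁ × S)) → relabel π (map (inl× {A₂ = A₂}) l) ≡ map inl× (relabel π l)
  relabel-inl× l = trans (sym (map-∘ l)) (map-∘ l)

  relabel-inr× : (l : 𝓑 (A₂ × S)) → relabel π (map (inr× {A₁}) l) ≡ map inr× (relabel π l)
  relabel-inr× l = trans (sym (map-∘ l)) (map-∘ l)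

  relabel-prodFlat : (l₁ : 𝓑 (A₁ × S)) (l₂ : 𝓑 (A₂ × S)) →
    relabel π (map inl× l₁ ++ map inr× l₂) ≡ map inl× (relabel π l₁) ++ map inr× (relabel π l₂)
  relabel-prodFlat l₁ l₂ =
    trans (map-++ (map₂ π) (map inl× l₁) (map inr× l₂))
          (cong₂ _++_ (relabel-inl× l₁) (relabel-inr× l₂))

module _ {Fn : SetFunctor} {A : Set} {♭ : Flat Fn A} {sig : F Fn 1ₛ × 𝓑 (A × ℕ) → F Fn ℕ}
         (I : IsSigInterface Fn ♭ sig) where
  open IsSigInterface I

  sig-eq′ : (S : Set) → IsFinite S → (π : S → ℕ) (t : F Fn S) {b : 𝓑 (A × ℕ)} →
            b ≡ relabel π (♭ S t) → fmap Fn π t ≡ sig (fmap Fn ! t , b)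
  sig-eq′ S fin π t refl = sig-eq S fin π t

module _ (F₁ F₂ : SetFunctor) {A₁ A₂ : Set} {♭₁ : Flat F₁ A₁} {♭₂ : Flat F₂ A₂}
         {sig₁ : F F₁ 1ₛ × 𝓑 (A₁ × ℕ) → F F₁ ℕ} {sig₂ : F F₂ 1ₛ × 𝓑 (A₂ × ℕ) → F F₂ ℕ}
         (I₁ : IsSigInterface F₁ ♭₁ sig₁) (I₂ : IsSigInterface F₂ ♭₂ sig₂) where
  private
    module I₁ = IsSigInterface I₁
    module I₂ = IsSigInterface I₂

  prodSig-isSigInterface : IsSigInterface (F₁ ⊗ F₂) (prodFlat F₁ F₂ ♭₁ ♭₂) (prodSig F₁ F₂ sig₁ sig₂)
  prodSig-isSigInterface = record
    { sig-resp = λ (t₁ , t₂) b b′ b≈b′ →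
        cong₂ _,_ (I₁.sig-resp t₁ _ _ (filter₁-resp b≈b′)) (I₂.sig-resp t₂ _ _ (filter₂-resp b≈b′))
    ; sig-eq = λ S fin π (t₁ , t₂) →
        let bag-eq = relabel-prodFlat π (♭₁ S t₁) (♭₂ S t₂) in
        cong₂ _,_
          (sig-eq′ I₁ S fin π t₁ (trans (cong filter₁ bag-eq) (filter₁-++ _ (relabel π (♭₂ S t₂)))))
          (sig-eq′ I₂ S fin π t₂ (trans (cong filter₂ bag-eq) (filter₂-++ (relabel π (♭₁ S t₁)) _)))
    }

  coprodSig-isSigInterface : IsSigInterface (F₁ ⊕ F₂) (coprodFlat F₁ F₂ ♭₁ ♭₂) (coprodSig F₁ F₂ sig₁ sig₂)
  coprodSig-isSigInterface = record { sig-resp = resp ; sig-eq = eq }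
    where
    resp : (t : F (F₁ ⊕ F₂) 1ₛ) (b b′ : 𝓑 ((A₁ ⊎ A₂) × ℕ)) → b ≈ᴮ b′ →
           coprodSig F₁ F₂ sig₁ sig₂ (t , b) ≡ coprodSig F₁ F₂ sig₁ sig₂ (t , b′)
    resp (inj₁ t) b b′ b≈b′ = cong inj₁ (I₁.sig-resp t _ _ (filter₁-resp b≈b′))
    resp (inj₂ t) b b′ b≈b′ = cong inj₂ (I₂.sig-resp t _ _ (filter₂-resp b≈b′))

    eq : (S : Set) → IsFinite S → (π : S → ℕ) (t : F (F₁ ⊕ F₂) S) →
         fmap (F₁ ⊕ F₂) π t ≡
         coprodSig F₁ F₂ sig₁ sig₂ (fmap (F₁ ⊕ F₂) ! t , relabel π (coprodFlat F₁ F₂ ♭₁ ♭₂ S t))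
    eq S fin π (inj₁ t) = cong inj₁ (sig-eq′ I₁ S fin π t
      (trans (cong filter₁ (relabel-inl× π (♭₁ S t))) (filter₁-inl× _)))
    eq S fin π (inj₂ t) = cong inj₂ (sig-eq′ I₂ S fin π t
      (trans (cong filter₂ (relabel-inr× π (♭₂ S t))) (filter₂-inr× _)))

proposition3p4 : (F₁ F₂ : SetFunctor) (E₁ : Encoding F₁) (E₂ : Encoding F₂)
    (sig₁ : F F₁ 1ₛ × 𝓑 (Label E₁ × ℕ) → F F₁ ℕ)
    (sig₂ : F F₂ 1ₛ × 𝓑 (Label E₂ × ℕ) → F F₂ ℕ) →
    IsSigInterface F₁ (flat E₁) sig₁ →
    IsSigInterface F₂ (flat E₂) sig₂ →
    IsSigInterface (F₁ ⊗ F₂) (prodFlat F₁ F₂ (flat E₁) (flat E₂)) (prodSig F₁ F₂ sig₁ sig₂)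
      × IsSigInterface (F₁ ⊕ F₂) (coprodFlat F₁ F₂ (flat E₁) (flat E₂)) (coprodSig F₁ F₂ sig₁ sig₂)
proposition3p4 F₁ F₂ E₁ E₂ sig₁ sig₂ I₁ I₂ =
  prodSig-isSigInterface F₁ F₂ I₁ I₂ , coprodSig-isSigInterface F₁ F₂ I₁ I₂
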